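{- Let $\mathsf{G}$ be a well-formed global type. (i) If $\mathsf{G}\!\upharpoonright\!\mathsf{p}=\mathsf{q}!\Lambda$ and $\mathsf{G}\!\upharpoonright\!\mathsf{q}=\mathsf{p}?\Lambda'$, then $\mathrm{lab}(\Lambda)=\mathrm{lab}(\Lambda')$; moreover, for every $\ell\in\mathrm{lab}(\Lambda)$ there is $\mathsf{G}^\ell$ with $\mathsf{G}\xrightarrow{\mathsf{p}\ell\mathsf{q}}\mathsf{G}^\ell$, $\ell.(\mathsf{G}^\ell\!\upharpoonright\!\mathsf{p})\in\Lambda$ and $\ell.(\mathsf{G}^\ell\!\upharpoonright\!\mathsf{q})\in\Lambda'$. (ii) If $\mathsf{G}\xrightarrow{\mathsf{p}\ell\mathsf{q}}\mathsf{G}'$, then $\mathsf{G}\!\upharpoonright\!\mathsf{p}=\mathsf{q}!\Lambda$ and $\mathsf{G}\!\upharpoonright\!\mathsf{q}=\mathsf{p}?\Lambda'$ for some $\Lambda,\Lambda'$ with $\ell\in\mathrm{lab}(\Lambda)=\mathrm{lab}(\Lambda')$.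
   Context: Processes are possibly infinite regular trees generated coinductively by $P ::= \mathbf{0}\mid \mathsf{p}?\Lambda\mid \mathsf{p}!\Lambda$ with $\Lambda=\{\ell_1.P_1,\dots,\ell_n.P_n\}$ ($n\ge1$, distinct messages); $\mathrm{lab}(\Lambda)=\{\ell_1,\dots,\ell_n\}$; $\Lambda_1\oplus\Lambda_2$ a union with disjoint label sets. Global types: regular trees generated coinductively by $\mathsf{G}::=\mathtt{end}\mid\mathsf{p}\to\mathsf{q}:\Gamma$, $\Gamma=\{\ell_i.\mathsf{G}_i\}_{i\le n}$ (distinct messages); $\ell.\mathsf{G}\oplus\Gamma$ denotes $\{\ell.\mathsf{G}\}\cup\Gamma$ with $\ell$ not a message of $\Gamma$; $\mathrm{pt}(\mathsf{G})$ its participants. Transitions: $\mathsf{p}\to\mathsf{q}:(\ell.\mathsf{G}\oplus\Gamma)\xrightarrow{\mathsf{p}\ell\mathsf{q}}\mathsf{G}$; and if $\mathsf{G}_i\xrightarrow{\mathsf{p}\ell\mathsf{q}}\mathsf{G}'_i$ for all $i\le n$ and $\{\mathsf{p},\mathsf{q}\}\cap\{\mathsf{r},\mathsf{s}\}=\emptyset$, then $\mathsf{r}\to\mathsf{s}:\{\ell_i.\mathsf{G}_i\}\xrightarrow{\mathsf{p}\ell\mathsf{q}}\mathsf{r}\to\mathsf{s}:\{\ell_i.\mathsf{G}'_i\}$. Projection (partial, coinductive): $\mathsf{G}\!\upharpoonright\!\mathsf{p}=\mathbf{0}$ if $\mathsf{p}\notin\mathrm{pt}(\mathsf{G})$; $(\mathsf{p}\to\mathsf{q}:\{\ell_i.\mathsf{G}_i\})\!\upharpoonright\!\mathsf{p}=\mathsf{q}!\{\ell_i.(\mathsf{G}_i\!\upharpoonright\!\mathsf{p})\}$;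 $(\mathsf{q}\to\mathsf{p}:\{\ell_i.\mathsf{G}_i\})\!\upharpoonright\!\mathsf{p}=\mathsf{q}?\{\ell_i.(\mathsf{G}_i\!\upharpoonright\!\mathsf{p})\}$; for $\mathsf{p}\notin\{\mathsf{q},\mathsf{r}\}$, $(\mathsf{q}\to\mathsf{r}:\{\ell_i.\mathsf{G}_i\}_{i\le n})\!\upharpoonright\!\mathsf{p}$ is $\mathsf{G}_1\!\upharpoonright\!\mathsf{p}$ if all $\mathsf{G}_i\!\upharpoonright\!\mathsf{p}$ coincide, is $\mathsf{s}?(\Lambda_1\oplus\cdots\oplus\Lambda_n)$ if each $\mathsf{G}_i\!\upharpoonright\!\mathsf{p}=\mathsf{s}?\Lambda_i$ with pairwise disjoint label sets, undefined otherwise. For a root path $\pi$ of $\mathsf{G}$, $d(\pi,\mathsf{p})$ is the number of communications before the first one involving $\mathsf{p}$ (the length of $\pi$, possibly $\infty$, if none); the weight of $\mathsf{p}$ is $\sup_\pi d(\pi,\mathsf{p})$ if $\mathsf{p}\in\mathrm{pt}(\mathsf{G})$, else $0$. $\mathsf{G}$ is well formed if each participant has finite weight and defined projection. -}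

module Defs where

open import Data.Nat using (ℕ; zero; suc; _≤_)
open import Data.Maybe using (Maybe; just; nothing; Is-just)
open import Data.Product using (Σ; ∃; _×_; _,_)
open import Data.Sum using (_⊎_)
open import Data.List using (List)
open import Data.List.Membership.Propositional using (_∈_)
open import Data.List.Relation.Unary.Any using (Any)
open import Relation.Binary.PropositionalEquality using (_≡_; _≢_)
open import Relation.Nullary using (¬_)
open import Data.Empty using (⊥)
open import Function.Bundles using (_⇔_)

Part : Set
Part = ℕ

Label : Set
Label = ℕ

-- A set of branches {ℓ₁.X₁,…,ℓₙ.Xₙ} with distinct messages is represented
-- as a partial map from messages to continuations; lab(Λ) is its domain.
Branches : Set → Set
Branches A = Label → Maybe A

_∈lab_ : {A : Set} → Label → Branches A → Set
ℓ ∈lab Λ = Is-just (Λ ℓ)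

data Dir : Set where
  send recv : Dir

mutual
  record Proc : Set where
    coinductive
    field out : ProcF

  data ProcF : Set where
    𝟎    : ProcF
    _!_  : Part → Branches Proc → ProcF
    _¿_  : Part → Branches Proc → ProcF

open Proc public

mutual
  record Global : Set where
    coinductive
    field node : GlobalF

  data GlobalF : Set where
    endG : GlobalF
    _⟶_∶_ : Part → Part → Branches Global → GlobalF

open Global public

record IsGT (G : Global) : Set where
  coinductive
  field
    isGT : (node G ≡ endG) ⊎
           (Σ Part λ p → Σ Part λ q → Σ (Branches Global) λ Γ →
              (node G ≡ (p ⟶ q ∶ Γ)) × (p ≢ q) ×
              (Σ Label λ ℓ → ℓ ∈lab Γ) ×
              (Σ (List Label) λ ls → ∀ ℓ → ℓ ∈lab Γ → ℓ ∈ ls) ×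
              (∀ ℓ G' → Γ ℓ ≡ just G' → IsGT G'))

record _≈G_ (G H : Global) : Set where
  coinductive
  field
    bisim : ((node G ≡ endG) × (node H ≡ endG)) ⊎
            (Σ Part λ p → Σ Part λ q → Σ (Branches Global) λ Γ →
             Σ (Branches Global) λ Δ →
              (node G ≡ (p ⟶ q ∶ Γ)) × (node H ≡ (p ⟶ q ∶ Δ)) ×
              (∀ ℓ → (ℓ ∈lab Γ) ⇔ (ℓ ∈lab Δ)) ×
              (∀ ℓ G' H' → Γ ℓ ≡ just G' → Δ ℓ ≡ just H' → G' ≈G H'))

data Subtree : Global → Global → Set where
  here  : ∀ {G} → Subtree G G
  there : ∀ {G p q Γ ℓ G' H} → node G ≡ (p ⟶ q ∶ Γ) → Γ ℓ ≡ just G' →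
          Subtree G' H → Subtree G H

Regular : Global → Set
Regular G = Σ (List Global) λ Gs → ∀ H → Subtree G H → Any (H ≈G_) Gs

data _∈pt_ (r : Part) (G : Global) : Set where
  ptSnd  : ∀ {q Γ} → node G ≡ (r ⟶ q ∶ Γ) → r ∈pt G
  ptRcv  : ∀ {p Γ} → node G ≡ (p ⟶ r ∶ Γ) → r ∈pt G
  ptDeep : ∀ {p q Γ ℓ G'} → node G ≡ (p ⟶ q ∶ Γ) → Γ ℓ ≡ just G' →
           r ∈pt G' → r ∈pt G

data Step : Global → Part → Label → Part → Global → Set where
  stepHere : ∀ {G p q Γ ℓ G'} → node G ≡ (p ⟶ q ∶ Γ) → Γ ℓ ≡ just G' →
             Step G p ℓ q G'
  stepDeep : ∀ {G G' p ℓ q r s Γ Γ'} →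
             node G ≡ (r ⟶ s ∶ Γ) → node G' ≡ (r ⟶ s ∶ Γ') →
             p ≢ r → p ≢ s → q ≢ r → q ≢ s →
             (∀ m → (m ∈lab Γ) ⇔ (m ∈lab Γ')) →
             (∀ m Gm Gm' → Γ m ≡ just Gm → Γ' m ≡ just Gm' → Step Gm p ℓ q Gm') →
             Step G p ℓ q G'

-- Projection, as a (coinductive) relation  Proj G p P  meaning  G↾p = P

mutual
  record Proj (G : Global) (p : Part) (P : Proc) : Set where
    coinductive
    field unfold : ProjF G p P

  data ProjF (G : Global) (p : Part) (P : Proc) : Set where
    prjNone  : ¬ (p ∈pt G) → out P ≡ 𝟎 → ProjF G p P
    prjSend  : ∀ {q Γ Λ} → node G ≡ (p ⟶ q ∶ Γ) → out P ≡ (q ! Λ) →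
               (∀ ℓ → (ℓ ∈lab Γ) ⇔ (ℓ ∈lab Λ)) →
               (∀ ℓ G' P' → Γ ℓ ≡ just G' → Λ ℓ ≡ just P' → Proj G' p P') →
               ProjF G p P
    prjRecv  : ∀ {q Γ Λ} → node G ≡ (q ⟶ p ∶ Γ) → out P ≡ (q ¿ Λ) →
               (∀ ℓ → (ℓ ∈lab Γ) ⇔ (ℓ ∈lab Λ)) →
               (∀ ℓ G' P' → Γ ℓ ≡ just G' → Λ ℓ ≡ just P' → Proj G' p P') →
               ProjF G p P
    prjSame  : ∀ {q r Γ} → p ∈pt G → node G ≡ (q ⟶ r ∶ Γ) → p ≢ q → p ≢ r →
               (∀ ℓ G' → Γ ℓ ≡ just G' → Proj G' p P) →
               ProjF G p P
    -- p ∈ pt(G), p ∉ {q,r}, Gᵢ↾p = s?Λᵢ with pairwise disjoint lab(Λᵢ),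
    -- and P = s?(Λ₁ ⊕ ⋯ ⊕ Λₙ)
    prjMerge : ∀ {q r s Γ Λ} → p ∈pt G → node G ≡ (q ⟶ r ∶ Γ) → p ≢ q → p ≢ r →
               out P ≡ (s ¿ Λ) →
               (Ps : Label → Proc) (Λs : Label → Branches Proc) →
               (∀ ℓ G' → Γ ℓ ≡ just G' → Proj G' p (Ps ℓ) × out (Ps ℓ) ≡ (s ¿ Λs ℓ)) →
               (∀ ℓ₁ ℓ₂ m → ℓ₁ ∈lab Γ → ℓ₂ ∈lab Γ → ℓ₁ ≢ ℓ₂ →
                  m ∈lab Λs ℓ₁ → m ∈lab Λs ℓ₂ → ⊥) →
               (∀ ℓ m P' → ℓ ∈lab Γ → Λs ℓ m ≡ just P' → Λ m ≡ just P') →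
               (∀ m → m ∈lab Λ → Σ Label λ ℓ → (ℓ ∈lab Γ) × (m ∈lab Λs ℓ)) →
               ProjF G p P

open Proj public

-- Avoid p G k : there is a root path of G of length k none of whose
-- communications involves p.  The weight of p ∈ pt(G) is the supremum of
-- d(π,p) over root paths π, which equals the supremum of such k.
data Avoid (p : Part) : Global → ℕ → Set where
  avNil  : ∀ {G} → Avoid p G 0
  avCons : ∀ {G q r Γ ℓ G' k} → node G ≡ (q ⟶ r ∶ Γ) → p ≢ q → p ≢ r →
           Γ ℓ ≡ just G' → Avoid p G' k → Avoid p G (suc k)

FiniteWeight : Global → Part → Set
FiniteWeight G p = p ∈pt G → Σ ℕ λ n → ∀ k → Avoid p G k → k ≤ n

record WellFormed (G : Global) : Set where
  field
    wfGT      : IsGT G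
    wfRegular : Regular G
    wfWeight  : ∀ p → FiniteWeight G p
    wfProj    : ∀ p → Σ Proc λ P → Proj G p P

-- Part (ii) is by induction on the transition: below a prefix r → s not involving
-- p and q, the projections onto p and q are uniform over (or, for q, merged from)
-- the branches, and the transition happens in some branch.  Part (i) is by
-- induction on the weight of p.  If G starts with p → q the message is taken
-- directly.  Otherwise G starts with r → s where p, q ∉ {r, s}; the projection
-- onto p is uniform over the branches and the one onto q merges the receives of
-- the branches, so by induction ℓ can be exchanged in every branch, and these
-- transitions reassemble below r → s.  The label equality in (ii) is then the
-- one of (i).
module Submission where

open import Defs
open import Data.Empty using (⊥; ⊥-elim)
open import Data.Maybe using (Maybe; just; nothing; Is-just)
open import Data.Maybe.Properties using (just-injective)
open import Data.Maybe.Relation.Unary.Any using () renaming (just to is-just)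
open import Data.Nat using (ℕ; suc; _≤_; s≤s)
open import Data.Product using (Σ; _×_; _,_; proj₁; proj₂)
open import Data.Sum using (inj₁; inj₂)
open import Data.Unit using (tt)
open import Function.Bundles using (_⇔_; mk⇔; Equivalence)
import Function.Properties.Equivalence as ⇔
open import Relation.Binary.PropositionalEquality using (_≡_; _≢_; refl; sym; trans)
open import Relation.Nullary using (Dec; yes; no)

open Equivalence

private
  variable
    A B : Set
    G G' H : Global
    p q r s a b c d : Part
    ℓ : Label
    n : ℕ
    Γ Γ' Δ : Branches Global
    Λ Λ' : Branches Proc
    P Q X : Proc

≡just⇒Is-just : {x : Maybe A} {y : A} → x ≡ just y → Is-just x
≡just⇒Is-just refl = is-just tt

Is-just⇒≡just : {x : Maybe A} → Is-just x → Σ A λ y → x ≡ just y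
Is-just⇒≡just (is-just _) = _ , refl

mapWith≡ : (x : Maybe A) → ((y : A) → x ≡ just y → B) → Maybe B
mapWith≡ nothing  f = nothing
mapWith≡ (just y) f = just (f y refl)

Is-just-mapWith≡ : (x : Maybe A) (f : (y : A) → x ≡ just y → B) →
                   Is-just x ⇔ Is-just (mapWith≡ x f)
Is-just-mapWith≡ nothing  f = mk⇔ (λ ()) (λ ())
Is-just-mapWith≡ (just y) f = mk⇔ (λ _ → is-just tt) (λ _ → is-just tt)

mapWith≡-just : (x : Maybe A) (f : (y : A) → x ≡ just y → B) {z : B} →
                mapWith≡ x f ≡ just z → Σ A λ y → Σ (x ≡ just y) λ e → f y e ≡ z
mapWith≡-just (just y) f refl = y , refl , refl

NonEmpty : Branches A → Set
NonEmpty Γ = Σ Label λ ℓ → ℓ ∈lab Γ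

𝟎≢! : {Λ : Branches Proc} → 𝟎 ≢ (q ! Λ)
𝟎≢! ()

𝟎≢¿ : {Λ : Branches Proc} → 𝟎 ≢ (q ¿ Λ)
𝟎≢¿ ()

!≢¿ : {Λ Λ' : Branches Proc} → (q ! Λ) ≢ (p ¿ Λ')
!≢¿ ()

!-injective : (q ! Λ) ≡ (p ! Λ') → q ≡ p × Λ ≡ Λ'
!-injective refl = refl , refl

¿-injective : (q ¿ Λ) ≡ (p ¿ Λ') → q ≡ p × Λ ≡ Λ'
¿-injective refl = refl , refl

𝟎? : (x : ProcF) → Dec (x ≡ 𝟎)
𝟎? 𝟎       = yes refl
𝟎? (_ ! _) = no λ ()
𝟎? (_ ¿ _) = no λ ()

interaction-unique : ∀ G → node G ≡ (a ⟶ b ∶ Γ) → node G ≡ (c ⟶ d ∶ Δ) →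
                     a ≡ c × b ≡ d × Γ ≡ Δ
interaction-unique G e e' with trans (sym e) e'
... | refl = refl , refl , refl

sender-unique : ∀ G → node G ≡ (a ⟶ b ∶ Γ) → node G ≡ (c ⟶ d ∶ Δ) → a ≡ c
sender-unique G e e' = proj₁ (interaction-unique G e e')

receiver-unique : ∀ G → node G ≡ (a ⟶ b ∶ Γ) → node G ≡ (c ⟶ d ∶ Δ) → b ≡ d
receiver-unique G e e' = proj₁ (proj₂ (interaction-unique G e e'))

IsGT-⟶ : IsGT G → node G ≡ (r ⟶ s ∶ Γ) →
         r ≢ s × NonEmpty Γ × (∀ ℓ G' → Γ ℓ ≡ just G' → IsGT G')
IsGT-⟶ {G} gt e with IsGT.isGT gt
... | inj₁ e' with trans (sym e') e
...   | ()
IsGT-⟶ {G} gt e | inj₂ (_ , _ , _ , e' , r≢s , ne , _ , sub) with interaction-unique G e' e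
... | refl , refl , refl = r≢s , ne , sub

proj-𝟎⇒∉pt : Proj H p X → out X ≡ 𝟎 → p ∈pt H → ⊥
proj-𝟎⇒∉pt {H} prX x≡𝟎 p∈ with unfold prX
... | prjNone p∉ _                  = p∉ p∈
... | prjSend _ e _ _               = 𝟎≢! (trans (sym x≡𝟎) e)
... | prjRecv _ e _ _               = 𝟎≢¿ (trans (sym x≡𝟎) e)
... | prjMerge _ _ _ _ e _ _ _ _ _ _ = 𝟎≢¿ (trans (sym x≡𝟎) e)
... | prjSame _ e p≢r p≢s sub       = go p∈
  where
  go : _ ∈pt H → ⊥
  go (ptSnd e')            = p≢r (sender-unique H e' e)
  go (ptRcv e')            = p≢s (receiver-unique H e' e)
  go (ptDeep e' eG p∈G') with interaction-unique H e' e
  ... | refl , refl , refl = proj-𝟎⇒∉pt (sub _ _ eG) x≡𝟎 p∈G'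

proj-non𝟎⇒∈pt : Proj H p X → out X ≢ 𝟎 → p ∈pt H
proj-non𝟎⇒∈pt prX x≢𝟎 with unfold prX
... | prjNone _ x≡𝟎                   = ⊥-elim (x≢𝟎 x≡𝟎)
... | prjSend e _ _ _                 = ptSnd e
... | prjRecv e _ _ _                 = ptRcv e
... | prjSame p∈ _ _ _ _              = p∈
... | prjMerge p∈ _ _ _ _ _ _ _ _ _ _ = p∈

proj-uniform : node H ≡ (r ⟶ s ∶ Γ) → p ≢ r → p ≢ s → NonEmpty Γ →
               (∀ ℓ G' → Γ ℓ ≡ just G' → Proj G' p X) → Proj H p X
unfold (proj-uniform {H} {X = X} e p≢r p≢s (ℓ₀ , ℓ₀∈) sub) with 𝟎? (out X)
... | yes x≡𝟎 = prjNone p∉ x≡𝟎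
  where
  p∉ : _ ∈pt H → ⊥
  p∉ (ptSnd e')            = p≢r (sender-unique H e' e)
  p∉ (ptRcv e')            = p≢s (receiver-unique H e' e)
  p∉ (ptDeep e' eG p∈G') with interaction-unique H e' e
  ... | refl , refl , refl = proj-𝟎⇒∉pt (sub _ _ eG) x≡𝟎 p∈G'
... | no x≢𝟎 with Is-just⇒≡just ℓ₀∈
...   | G₀ , eG₀ =
  prjSame (ptDeep e eG₀ (proj-non𝟎⇒∈pt (sub ℓ₀ G₀ eG₀) x≢𝟎)) e p≢r p≢s sub

shared-branch : NonEmpty Γ → (∀ m → (m ∈lab Γ) ⇔ (m ∈lab Γ')) →
                Σ Label λ m → Σ Global λ Gm → Γ m ≡ just Gm ×
                              Σ Global λ Gm' → Γ' m ≡ just Gm'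
shared-branch (m , m∈) labs with Is-just⇒≡just m∈ | Is-just⇒≡just (to (labs m) m∈)
... | Gm , e | Gm' , e' = m , Gm , e , Gm' , e'

step-participants : Step G p ℓ q G' → IsGT G → p ∈pt G × q ∈pt G
step-participants (stepHere e _) _ = ptSnd e , ptRcv e
step-participants (stepDeep e _ _ _ _ _ labs steps) gt
  with IsGT-⟶ gt e
... | _ , ne , branchGT with shared-branch ne labs
... | m , Gm , eGm , Gm' , eGm'
  with step-participants (steps m Gm Gm' eGm eGm') (branchGT m Gm eGm)
... | p∈ , q∈ = ptDeep e eGm p∈ , ptDeep e eGm q∈

step⇒proj-send : Step G p ℓ q G' → IsGT G → Proj G p P →
                 Σ (Branches Proc) λ Λ → out P ≡ (q ! Λ) × ℓ ∈lab Λ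
step⇒proj-send {G} {ℓ = ℓ} (stepHere e eG) gt prP with IsGT-⟶ gt e | unfold prP
... | _ | prjNone p∉ _                      = ⊥-elim (p∉ (ptSnd e))
... | p≢q , _ | prjRecv e' _ _ _            = ⊥-elim (p≢q (sym (receiver-unique G e e')))
... | _ | prjSame _ e' p≢p _ _              = ⊥-elim (p≢p (sender-unique G e e'))
... | _ | prjMerge _ e' p≢p _ _ _ _ _ _ _ _ = ⊥-elim (p≢p (sender-unique G e e'))
... | _ | prjSend e' eP labs _ with interaction-unique G e e'
...   | refl , refl , refl = _ , eP , to (labs ℓ) (≡just⇒Is-just eG)
step⇒proj-send {G} st@(stepDeep e _ p≢r p≢s _ _ labs steps) gt prP with IsGT-⟶ gt e
... | _ , ne , branchGT with shared-branch ne labs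
... | m , Gm , eGm , Gm' , eGm' with unfold prP
... | prjNone p∉ _     = ⊥-elim (p∉ (proj₁ (step-participants st gt)))
... | prjSend e' _ _ _ = ⊥-elim (p≢r (sender-unique G e' e))
... | prjRecv e' _ _ _ = ⊥-elim (p≢s (receiver-unique G e' e))
... | prjSame _ e' _ _ sub with interaction-unique G e' e
...   | refl , refl , refl =
  step⇒proj-send (steps m Gm Gm' eGm eGm') (branchGT m Gm eGm) (sub m Gm eGm)
step⇒proj-send {G} (stepDeep e _ _ _ _ _ _ steps) gt prP
  | _ , _ , branchGT | m , Gm , eGm , Gm' , eGm' | prjMerge _ e' _ _ _ _ _ sub _ _ _
  with interaction-unique G e' e
...   | refl , refl , refl
  with step⇒proj-send (steps m Gm Gm' eGm eGm') (branchGT m Gm eGm) (proj₁ (sub m Gm eGm))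
...   | _ , eP , _ = ⊥-elim (!≢¿ (trans (sym eP) (proj₂ (sub m Gm eGm))))

step⇒proj-recv : Step G p ℓ q G' → IsGT G → Proj G q Q →
                 Σ (Branches Proc) λ Λ' → out Q ≡ (p ¿ Λ')
step⇒proj-recv {G} (stepHere e _) gt prQ with IsGT-⟶ gt e | unfold prQ
... | _ | prjNone q∉ _                      = ⊥-elim (q∉ (ptRcv e))
... | p≢q , _ | prjSend e' _ _ _            = ⊥-elim (p≢q (sender-unique G e e'))
... | _ | prjSame _ e' _ q≢q _              = ⊥-elim (q≢q (receiver-unique G e e'))
... | _ | prjMerge _ e' _ q≢q _ _ _ _ _ _ _ = ⊥-elim (q≢q (receiver-unique G e e'))
... | _ | prjRecv e' eQ _ _ with interaction-unique G e e'
...   | refl , refl , refl = _ , eQ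
step⇒proj-recv {G} st@(stepDeep e _ _ _ q≢r q≢s labs steps) gt prQ with IsGT-⟶ gt e
... | _ , ne , branchGT with shared-branch ne labs
... | m , Gm , eGm , Gm' , eGm' with unfold prQ
... | prjNone q∉ _     = ⊥-elim (q∉ (proj₂ (step-participants st gt)))
... | prjSend e' _ _ _ = ⊥-elim (q≢r (sender-unique G e' e))
... | prjRecv e' _ _ _ = ⊥-elim (q≢s (receiver-unique G e' e))
... | prjSame _ e' _ _ sub with interaction-unique G e' e
...   | refl , refl , refl =
  step⇒proj-recv (steps m Gm Gm' eGm eGm') (branchGT m Gm eGm) (sub m Gm eGm)
step⇒proj-recv {G} (stepDeep e _ _ _ _ _ _ steps) gt prQ
  | _ , _ , branchGT | m , Gm , eGm , Gm' , eGm' | prjMerge _ e' _ _ eQ _ _ sub _ _ _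
  with interaction-unique G e' e
...   | refl , refl , refl
  with step⇒proj-recv (steps m Gm Gm' eGm eGm') (branchGT m Gm eGm) (proj₁ (sub m Gm eGm))
...   | _ , eQm with ¿-injective (trans (sym eQm) (proj₂ (sub m Gm eGm)))
...   | refl , _ = _ , eQ

WeightAtMost : Part → Global → ℕ → Set
WeightAtMost p G n = ∀ k → Avoid p G k → k ≤ n

weight-positive : node G ≡ (r ⟶ s ∶ Γ) → p ≢ r → p ≢ s → NonEmpty Γ →
                  WeightAtMost p G n → Σ ℕ λ n' → n ≡ suc n'
weight-positive e p≢r p≢s (m , m∈) w with Is-just⇒≡just m∈
... | _ , eG with w 1 (avCons e p≢r p≢s eG avNil)
... | s≤s _ = _ , refl

weight-branch : node G ≡ (r ⟶ s ∶ Γ) → p ≢ r → p ≢ s →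
                ∀ {m Gm} → Γ m ≡ just Gm → WeightAtMost p G (suc n) → WeightAtMost p Gm n
weight-branch e p≢r p≢s eG w k av with w (suc k) (avCons e p≢r p≢s eG av)
... | s≤s k≤n = k≤n

Fires : Global → Part → Label → Part → Branches Proc → Branches Proc → Set
Fires G p ℓ q Λ Λ' = Σ Global λ Gℓ → Step G p ℓ q Gℓ ×
                       (Σ Proc λ Pℓ → Λ ℓ ≡ just Pℓ × Proj Gℓ p Pℓ) ×
                       (Σ Proc λ Qℓ → Λ' ℓ ≡ just Qℓ × Proj Gℓ q Qℓ)

Matching : Global → Part → Part → Branches Proc → Branches Proc → Set
Matching G p q Λ Λ' = (∀ ℓ → (ℓ ∈lab Λ) ⇔ (ℓ ∈lab Λ')) ×
                      (∀ ℓ → ℓ ∈lab Λ → Fires G p ℓ q Λ Λ')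

matching-here : node G ≡ (p ⟶ q ∶ Γ) →
                (∀ ℓ → (ℓ ∈lab Γ) ⇔ (ℓ ∈lab Λ)) →
                (∀ ℓ G' P' → Γ ℓ ≡ just G' → Λ ℓ ≡ just P' → Proj G' p P') →
                Proj G q Q → out Q ≡ (p ¿ Λ') → Matching G p q Λ Λ'
matching-here {G} {p} {q} {Λ = Λ} {Λ' = Λ'} e labsP subP prQ eQ with unfold prQ
... | prjNone _ e𝟎                    = ⊥-elim (𝟎≢¿ (trans (sym e𝟎) eQ))
... | prjSend _ e! _ _                = ⊥-elim (!≢¿ (trans (sym e!) eQ))
... | prjSame _ e' _ q≢q _            = ⊥-elim (q≢q (receiver-unique G e e'))
... | prjMerge _ e' _ q≢q _ _ _ _ _ _ _ = ⊥-elim (q≢q (receiver-unique G e e'))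
... | prjRecv e' eQ' labsQ subQ with interaction-unique G e e' | ¿-injective (trans (sym eQ') eQ)
...   | refl , refl , refl | refl , refl = labs , fires
  where
  labs : ∀ ℓ → (ℓ ∈lab Λ) ⇔ (ℓ ∈lab Λ')
  labs ℓ = ⇔.trans (⇔.sym (labsP ℓ)) (labsQ ℓ)
  fires : ∀ ℓ → ℓ ∈lab Λ → Fires G p ℓ q Λ Λ'
  fires ℓ ℓ∈ with Is-just⇒≡just (from (labsP ℓ) ℓ∈)
                | Is-just⇒≡just ℓ∈
                | Is-just⇒≡just (to (labs ℓ) ℓ∈)
  ... | Gℓ , eG | Pℓ , eP | Qℓ , eQℓ =
    Gℓ , stepHere e eG ,
    (Pℓ , eP , subP ℓ Gℓ Pℓ eG eP) , (Qℓ , eQℓ , subQ ℓ Gℓ Qℓ eG eQℓ)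

-- Both the uniform and the merging projection rule produce this shape, the uniform
-- one with every branch projecting to the receive itself.
record MergedReceive (r s q p : Part) (Γ : Branches Global) (Λ' : Branches Proc) : Set where
  field
    q≢r            : q ≢ r
    q≢s            : q ≢ s
    proc           : Label → Proc
    branches       : Label → Branches Proc
    proj           : ∀ m Gm → Γ m ≡ just Gm → Proj Gm q (proc m)
    proc-¿         : ∀ m Gm → Γ m ≡ just Gm → out (proc m) ≡ (p ¿ branches m)
    branches⊆      : ∀ m ℓ Q → m ∈lab Γ → branches m ℓ ≡ just Q → Λ' ℓ ≡ just Q
    branches-cover : ∀ ℓ → ℓ ∈lab Λ' → Σ Label λ m → m ∈lab Γ × ℓ ∈lab branches m

merged-receive : node G ≡ (r ⟶ s ∶ Γ) → p ≢ r → NonEmpty Γ →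
                 Proj G q Q → out Q ≡ (p ¿ Λ') → MergedReceive r s q p Γ Λ'
merged-receive {G} e p≢r _ prQ eQ with unfold prQ
... | prjNone _ e𝟎       = ⊥-elim (𝟎≢¿ (trans (sym e𝟎) eQ))
... | prjSend _ e! _ _   = ⊥-elim (!≢¿ (trans (sym e!) eQ))
... | prjRecv e' e¿ _ _ with ¿-injective (trans (sym e¿) eQ)
...   | refl , _ = ⊥-elim (p≢r (sender-unique G e' e))
merged-receive {G} {Λ' = Λ'} e p≢r (m₀ , m₀∈) prQ eQ | prjSame _ e' q≢r q≢s sub
  with interaction-unique G e' e
... | refl , refl , refl = record
  { q≢r = q≢r ; q≢s = q≢s ; proc = λ _ → _ ; branches = λ _ → Λ'
  ; proj = sub ; proc-¿ = λ _ _ _ → eQ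
  ; branches⊆ = λ _ _ _ _ eQ' → eQ' ; branches-cover = λ _ ℓ∈ → m₀ , m₀∈ , ℓ∈ }
merged-receive {G} e p≢r _ prQ eQ | prjMerge _ e' q≢r q≢s e¿ Qs Λs sub _ incl cover
  with interaction-unique G e' e | ¿-injective (trans (sym e¿) eQ)
... | refl , refl , refl | refl , refl = record
  { q≢r = q≢r ; q≢s = q≢s ; proc = Qs ; branches = Λs
  ; proj = λ m Gm eGm → proj₁ (sub m Gm eGm) ; proc-¿ = λ m Gm eGm → proj₂ (sub m Gm eGm)
  ; branches⊆ = incl ; branches-cover = cover }

lift-step : node G ≡ (r ⟶ s ∶ Γ) → p ≢ r → p ≢ s → q ≢ r → q ≢ s → NonEmpty Γ →
            (∀ m Gm → Γ m ≡ just Gm →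
               Σ Global λ Gm' → Step Gm p ℓ q Gm' × Proj Gm' p P × Proj Gm' q Q) →
            Σ Global λ G' → Step G p ℓ q G' × Proj G' p P × Proj G' q Q
lift-step {r = r} {s} {Γ} {p} {q} {ℓ} {P} {Q} e p≢r p≢s q≢r q≢s (m₀ , m₀∈) next =
  Gℓ , stepDeep e refl p≢r p≢s q≢r q≢s labs steps ,
  proj-uniform {Gℓ} refl p≢r p≢s ne' projP , proj-uniform {Gℓ} refl q≢r q≢s ne' projQ
  where
  Γℓ : Branches Global
  Γℓ m = mapWith≡ (Γ m) (λ Gm e → proj₁ (next m Gm e))

  Gℓ : Global
  node Gℓ = r ⟶ s ∶ Γℓ

  labs : ∀ m → (m ∈lab Γ) ⇔ (m ∈lab Γℓ)
  labs m = Is-just-mapWith≡ (Γ m) _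

  ne' : NonEmpty Γℓ
  ne' = m₀ , to (labs m₀) m₀∈

  origin : ∀ m Gm' → Γℓ m ≡ just Gm' →
           Σ Global λ Gm → Γ m ≡ just Gm ×
                           Step Gm p ℓ q Gm' × Proj Gm' p P × Proj Gm' q Q
  origin m Gm' e' with mapWith≡-just (Γ m) _ e'
  ... | Gm , eGm , refl = Gm , eGm , proj₂ (next m Gm eGm)

  steps : ∀ m Gm Gm' → Γ m ≡ just Gm → Γℓ m ≡ just Gm' → Step Gm p ℓ q Gm'
  steps m Gm Gm' eGm e' with origin m Gm' e'
  ... | Gm₁ , eGm₁ , st , _ with just-injective (trans (sym eGm) eGm₁)
  ...   | refl = st

  projP : ∀ m Gm' → Γℓ m ≡ just Gm' → Proj Gm' p P
  projP m Gm' e' = let _ , _ , _ , prP , _ = origin m Gm' e' in prP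

  projQ : ∀ m Gm' → Γℓ m ≡ just Gm' → Proj Gm' q Q
  projQ m Gm' e' = let _ , _ , _ , _ , prQ = origin m Gm' e' in prQ

matching-merge : node G ≡ (r ⟶ s ∶ Γ) → p ≢ r → p ≢ s → NonEmpty Γ →
                 (M : MergedReceive r s q p Γ Λ') →
                 (∀ m Gm → Γ m ≡ just Gm → Matching Gm p q Λ (MergedReceive.branches M m)) →
                 Matching G p q Λ Λ'
matching-merge {G} {Γ = Γ} {p = p} {q = q} {Λ' = Λ'} {Λ = Λ} e p≢r p≢s ne@(m₀ , m₀∈) M IH = labs , fires
  where
  open MergedReceive M

  labs : ∀ ℓ → (ℓ ∈lab Λ) ⇔ (ℓ ∈lab Λ')
  labs ℓ = mk⇔ fwd bwd
    where
    fwd : ℓ ∈lab Λ → ℓ ∈lab Λ'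
    fwd ℓ∈ with Is-just⇒≡just m₀∈
    ... | G₀ , eG₀ with Is-just⇒≡just (to (proj₁ (IH m₀ G₀ eG₀) ℓ) ℓ∈)
    ... | Q₀ , eQ₀ = ≡just⇒Is-just (branches⊆ m₀ ℓ Q₀ m₀∈ eQ₀)
    bwd : ℓ ∈lab Λ' → ℓ ∈lab Λ
    bwd ℓ∈ with branches-cover ℓ ℓ∈
    ... | m , m∈ , ℓ∈m with Is-just⇒≡just m∈
    ... | Gm , eGm = from (proj₁ (IH m Gm eGm) ℓ) ℓ∈m

  fires : ∀ ℓ → ℓ ∈lab Λ → Fires G p ℓ q Λ Λ'
  fires ℓ ℓ∈ with Is-just⇒≡just ℓ∈ | Is-just⇒≡just (to (labs ℓ) ℓ∈)
  ... | Pℓ , ePℓ | Qℓ , eQℓ with lift-step e p≢r p≢s q≢r q≢s ne next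
    where
    next : ∀ m Gm → Γ m ≡ just Gm →
           Σ Global λ Gm' → Step Gm p ℓ q Gm' × Proj Gm' p Pℓ × Proj Gm' q Qℓ
    next m Gm eGm with proj₂ (IH m Gm eGm) ℓ ℓ∈
    ... | Gm' , st , (P' , eP' , prP') , (Q' , eQ' , prQ')
      with just-injective (trans (sym eP') ePℓ)
         | just-injective (trans (sym (branches⊆ m ℓ Q' (≡just⇒Is-just eGm) eQ')) eQℓ)
    ... | refl | refl = Gm' , st , prP' , prQ'
  ... | Gℓ , st , prP , prQ = Gℓ , st , (Pℓ , ePℓ , prP) , (Qℓ , eQℓ , prQ)

matching : ∀ n → IsGT G → WeightAtMost p G n →
           Proj G p P → out P ≡ (q ! Λ) → Proj G q Q → out Q ≡ (p ¿ Λ') → Matching G p q Λ Λ'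
matching n gt w prP eP prQ eQ with unfold prP
... | prjNone _ e𝟎                    = ⊥-elim (𝟎≢! (trans (sym e𝟎) eP))
... | prjRecv _ e¿ _ _                = ⊥-elim (!≢¿ (trans (sym eP) e¿))
... | prjMerge _ _ _ _ e¿ _ _ _ _ _ _ = ⊥-elim (!≢¿ (trans (sym eP) e¿))
... | prjSend e e! labsP subP with !-injective (trans (sym e!) eP)
...   | refl , refl = matching-here e labsP subP prQ eQ
matching {p = p} {q = q} {Λ' = Λ'} n gt w prP eP prQ eQ
  | prjSame {q = r} {s} {Γ} _ e p≢r p≢s subP
  with IsGT-⟶ gt e
... | _ , ne , branchGT with weight-positive e p≢r p≢s ne w
...   | n' , refl =
  matching-merge e p≢r p≢s ne M λ m Gm eGm →
    matching n' (branchGT m Gm eGm) (weight-branch e p≢r p≢s eGm w)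
             (subP m Gm eGm) eP (proj m Gm eGm) (proc-¿ m Gm eGm)
  where
  M : MergedReceive r s q p Γ Λ'
  M = merged-receive e p≢r ne prQ eQ
  open MergedReceive M

WellFormed⇒matching : WellFormed G → ∀ p q (P Q : Proc) (Λ Λ' : Branches Proc) →
                      Proj G p P → out P ≡ (q ! Λ) → Proj G q Q → out Q ≡ (p ¿ Λ') →
                      Matching G p q Λ Λ'
WellFormed⇒matching wf p q P Q Λ Λ' prP eP prQ eQ
  with WellFormed.wfWeight wf p (proj-non𝟎⇒∈pt prP λ e𝟎 → 𝟎≢! (trans (sym e𝟎) eP))
... | n , w = matching n (WellFormed.wfGT wf) w prP eP prQ eQ

WellFormed⇒step-projections :
  WellFormed G → ∀ p ℓ q G' → Step G p ℓ q G' →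
  Σ Proc λ P → Σ Proc λ Q → Σ (Branches Proc) λ Λ → Σ (Branches Proc) λ Λ' →
    Proj G p P × out P ≡ (q ! Λ) × Proj G q Q × out Q ≡ (p ¿ Λ') ×
    ℓ ∈lab Λ × (∀ m → (m ∈lab Λ) ⇔ (m ∈lab Λ'))
WellFormed⇒step-projections wf p ℓ q G' st
  with WellFormed.wfProj wf p | WellFormed.wfProj wf q
... | P , prP | Q , prQ
  with step⇒proj-send st (WellFormed.wfGT wf) prP | step⇒proj-recv st (WellFormed.wfGT wf) prQ
... | Λ , eP , ℓ∈ | Λ' , eQ =
  P , Q , Λ , Λ' , prP , eP , prQ , eQ , ℓ∈ ,
  proj₁ (WellFormed⇒matching wf p q P Q Λ Λ' prP eP prQ eQ)

mainTheorem7 : ∀ (G : Global) → WellFormed G →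
    -- (i)
    (∀ p q (P Q : Proc) (Λ Λ' : Branches Proc) →
       Proj G p P → out P ≡ (q ! Λ) →
       Proj G q Q → out Q ≡ (p ¿ Λ') →
       (∀ ℓ → (ℓ ∈lab Λ) ⇔ (ℓ ∈lab Λ')) ×
       (∀ ℓ → ℓ ∈lab Λ →
          Σ Global λ Gℓ → Step G p ℓ q Gℓ ×
            (Σ Proc λ Pℓ → Λ ℓ ≡ just Pℓ × Proj Gℓ p Pℓ) ×
            (Σ Proc λ Qℓ → Λ' ℓ ≡ just Qℓ × Proj Gℓ q Qℓ)))
    ×
    -- (ii)
    (∀ p ℓ q G' → Step G p ℓ q G' →
       Σ Proc λ P → Σ Proc λ Q → Σ (Branches Proc) λ Λ → Σ (Branches Proc) λ Λ' →
         Proj G p P × out P ≡ (q ! Λ) ×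
         Proj G q Q × out Q ≡ (p ¿ Λ') ×
         ℓ ∈lab Λ × (∀ m → (m ∈lab Λ) ⇔ (m ∈lab Λ')))
mainTheorem7 G wf = WellFormed⇒matching wf , WellFormed⇒step-projections wf
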